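{- Let $q$ be a prime power and $n,k,r$ positive integers with $k-r\le n/2$, $k\le n$ and $r\ge2$. For every $(k-r)$-dimensional $\mathbb{F}_q$-subspace $S$ of $\mathbb{F}_{q^n}$ there exists an $r$-dimensional $\mathbb{F}_q$-subspace $T$ of $\mathbb{F}_{q^n}$ such that the $\mathbb{F}_q$-linear set $L_{S\times T}$ of rank $k$ in $\mathrm{PG}(1,q^n)$ has no points of weight $r$ apart from $\langle(0,1)\rangle_{\mathbb{F}_{q^n}}$ and (when $k-r=r$) $\langle(1,0)\rangle_{\mathbb{F}_{q^n}}$.
   Context: For an $\mathbb{F}_q$-subspace $U$ of $\mathbb{F}_{q^n}^2$, $L_U=\{\langle u\rangle_{\mathbb{F}_{q^n}}: u\in U\setminus\{0\}\}\subseteq\mathrm{PG}(1,q^n)$, its rank is $\dim_{\mathbb{F}_q}U$, and the weight of a point $\langle v\rangle_{\mathbb{F}_{q^n}}$ is $\dim_{\mathbb{F}_q}(U\cap\langle v\rangle_{\mathbb{F}_{q^n}})$. $S\times T=\{(s,t):s\in S,t\in T\}$. -}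

module Defs where

open import Level using (Level; _⊔_) renaming (suc to lsuc)
open import Data.Nat using (ℕ; zero; suc; _≤_; _^_)
open import Data.Nat.Primality using (Prime)
open import Data.Fin using (Fin)
import Data.Fin as Fin
open import Data.Product using (Σ; ∃; _×_; _,_; proj₁; proj₂)
open import Relation.Nullary using (¬_)
open import Relation.Binary.PropositionalEquality using (_≡_)
open import Algebra.Bundles using (CommutativeRing)
open import Data.Unit using (⊤)

IsPrimePower : ℕ → Set
IsPrimePower q = Σ ℕ λ p → Σ ℕ λ m → Prime p × 1 ≤ m × q ≡ p ^ m

-- Generic F_q-linear algebra in a module V over a ring E, where the
-- scalars are restricted to a subset K of E (the subfield F_q).

module LinAlg {c ℓ : Level} {E : Set c} (_≈E_ : E → E → Set ℓ) (0E : E)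
              (K : E → Set ℓ)
              {v : Level} (V : Set v) (_≈_ : V → V → Set ℓ)
              (_+_ : V → V → V) (0V : V) (_·_ : E → V → V) where

  lc : {d : ℕ} → (Fin d → E) → (Fin d → V) → V
  lc {zero}  cs bs = 0V
  lc {suc d} cs bs = (cs Fin.zero · bs Fin.zero) + lc (λ i → cs (Fin.suc i)) (λ i → bs (Fin.suc i))

  KCoeffs : {d : ℕ} → (Fin d → E) → Set ℓ
  KCoeffs cs = ∀ i → K (cs i)

  LinIndep : {d : ℕ} → (Fin d → V) → Set (c ⊔ ℓ)
  LinIndep {d} bs = (cs : Fin d → E) → KCoeffs cs → lc cs bs ≈ 0V → ∀ i → cs i ≈E 0E

  Spans : {p : Level} (P : V → Set p) → {d : ℕ} → (Fin d → V) → Set (c ⊔ v ⊔ ℓ ⊔ p)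
  Spans P {d} bs = ∀ x → P x → Σ (Fin d → E) λ cs → KCoeffs cs × (x ≈ lc cs bs)

  record IsSubspace {p : Level} (P : V → Set p) : Set (c ⊔ v ⊔ ℓ ⊔ p) where
    field
      resp   : ∀ {x y} → x ≈ y → P x → P y
      has-0  : P 0V
      +-closed : ∀ {x y} → P x → P y → P (x + y)
      ·-closed : ∀ {a x} → K a → P x → P (a · x)

  HasDim : {p : Level} (P : V → Set p) → ℕ → Set (c ⊔ v ⊔ ℓ ⊔ p)
  HasDim P d = Σ (Fin d → V) λ bs → (∀ i → P (bs i)) × LinIndep bs × Spans P bs

record FieldExt (c ℓ : Level) (q n : ℕ) : Set (lsuc (c ⊔ ℓ)) where
  field
    E : CommutativeRing c ℓ
  open CommutativeRing E public
  field
    1≉0   : ¬ (1# ≈ 0#)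
    inv   : ∀ x → ¬ (x ≈ 0#) → Σ Carrier λ y → (x * y) ≈ 1#
    K       : Carrier → Set ℓ
    K-resp  : ∀ {x y} → x ≈ y → K x → K y
    K-0     : K 0#
    K-1     : K 1#
    K-+     : ∀ {x y} → K x → K y → K (x + y)
    K-neg   : ∀ {x} → K x → K (- x)
    K-*     : ∀ {x y} → K x → K y → K (x * y)
    K-inv   : ∀ {x y} → K x → (x * y) ≈ 1# → K y
    Kelem     : Fin q → Carrier
    Kelem-K   : ∀ i → K (Kelem i)
    Kelem-inj : ∀ i j → Kelem i ≈ Kelem j → i ≡ j
    Kelem-sur : ∀ x → K x → Σ (Fin q) λ i → x ≈ Kelem i

  module LE = LinAlg _≈_ 0# K Carrier _≈_ _+_ 0# _*_

  field
    degree : LE.HasDim (λ _ → ⊤) n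

module Proj {c ℓ : Level} {q n : ℕ} (F : FieldExt c ℓ q n) where
  open FieldExt F public

  E² : Set c
  E² = Carrier × Carrier

  _≈²_ : E² → E² → Set ℓ
  (a , b) ≈² (a′ , b′) = (a ≈ a′) × (b ≈ b′)

  _+²_ : E² → E² → E²
  (a , b) +² (a′ , b′) = (a + a′) , (b + b′)

  0² : E²
  0² = 0# , 0#

  _·²_ : Carrier → E² → E²
  λ′ ·² (a , b) = (λ′ * a) , (λ′ * b)

  module L2 = LinAlg _≈_ 0# K E² _≈²_ _+²_ 0² _·²_

  _⊠_ : (Carrier → Set ℓ) → (Carrier → Set ℓ) → E² → Set ℓ
  (S ⊠ T) (s , t) = S s × T t

  ⟨_⟩ : E² → E² → Set (c ⊔ ℓ)
  ⟨ v ⟩ w = Σ Carrier λ a → w ≈² (a ·² v)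

  -- the point ⟨u⟩ equals the point ⟨w⟩ (for nonzero u, w)
  SamePoint : E² → E² → Set (c ⊔ ℓ)
  SamePoint u w = ⟨ w ⟩ u

  -- the weight of the point ⟨v⟩ w.r.t. U is d:  dim_K (U ∩ ⟨v⟩_E) = d
  HasWeight : (U : E² → Set ℓ) → E² → ℕ → Set (c ⊔ ℓ)
  HasWeight U v d = L2.HasDim (λ x → U x × ⟨ v ⟩ x) d

{-# OPTIONS --safe #-}
-- Pick x ∈ F_{q^n} outside F_q and not a quotient b/a of nonzero a, b ∈ S: only q + (q^s − 1)² < q^n
-- elements must be avoided, as 2s ≤ n. Let T be any r-dimensional F_q-subspace containing 1 and x.
-- A point ⟨(s₀, t₀)⟩ with s₀ t₀ ≠ 0 meets S × T in {(ρt, t)}, ρ = s₀/t₀, with t ranging over a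
-- subspace of T; weight r makes that subspace all of T, so ρ and ρx lie in S, contradicting the
-- choice of x. A point ⟨(s₀, 0)⟩ meets S × T in S × {0}, whose dimension is s.
-- As F_{q^n} is finite, its equality is decidable and dimensions can be compared by counting.
module Submission where

open import Defs
open import Level using (Level; _⊔_)
open import Algebra.Bundles using (CommutativeRing)
open import Data.Nat using (ℕ; zero; suc; _≤_; _<_; _∸_; _*_; _^_; _≤′_; ≤′-refl; ≤′-step; z≤n; s≤s; NonZero; >-nonZero)
import Data.Nat as ℕ
open import Data.Nat.Properties
  using (≤-trans; ≤-reflexive; <⇒≤; <⇒≱; ≮⇒≥; n≮n; ≤-antisym; ≤⇒≤′; +-monoˡ-≤; +-monoʳ-<;
         m<n+m; ^-identityʳ; ^-monoʳ-≤; ^-monoʳ-<; ^-distribˡ-+-*; module ≤-Reasoning)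
import Data.Nat.Properties as ℕₚ
open import Data.Fin using (Fin; zero; suc; _↑ˡ_; _↑ʳ_; combine; remQuot; punchIn; punchOut; finToFun; funToFin; _≟_)
open import Data.Fin.Properties
  using (any?; all?; ¬∀⟶∃¬; injective⇒≤; remQuot-combine; punchInᵢ≢i; punchIn-punchOut;
         funToFin-finToFin; finToFun-funToFin)
open import Data.Vec.Functional using ([]; _∷_; _++_)
open import Data.Vec.Functional.Properties using (lookup-++ˡ; lookup-++ʳ)
open import Data.Product using (Σ; ∃; _×_; _,_; proj₁; proj₂; uncurry) renaming (map to Σ-map)
open import Data.Sum using (_⊎_; inj₁; inj₂)
open import Data.Unit using (tt)
open import Data.Empty using (⊥-elim)
open import Function using (_∘_; id)
open import Function.Definitions using (Injective)
open import Relation.Nullary using (¬_; Dec; yes; no; ¬?; contradiction)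
open import Relation.Nullary.Decidable using (decidable-stable; map′)
open import Relation.Binary.PropositionalEquality using (_≡_; _≢_; _≗_)
import Relation.Binary.PropositionalEquality as ≡

q+p*p<q^n : ∀ {q s p n} → 1 < q → q ^ s ≡ suc p → 2 * s ≤ n → 2 ≤ n → q ℕ.+ p * p < q ^ n
q+p*p<q^n {q} {zero} {n = n} 1<q ≡.refl _ 2≤n = begin-strict
  q ℕ.+ 0   ≡⟨ ℕₚ.+-identityʳ q ⟩
  q         ≡⟨ ≡.sym (^-identityʳ q) ⟩
  q ^ 1     <⟨ ^-monoʳ-< q 1<q 2≤n ⟩
  q ^ n     ∎
  where open ≤-Reasoning
q+p*p<q^n {q} {s@(suc _)} {p} {n} 1<q qˢ≡1+p 2s≤n _ = begin-strict
  q ℕ.+ p * p                 ≤⟨ +-monoˡ-≤ (p * p) q≤1+p ⟩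
  suc p ℕ.+ p * p             <⟨ +-monoʳ-< (suc p) (m<n+m (p * p) 0<p) ⟩
  suc p ℕ.+ (p ℕ.+ p * p)     ≡⟨ ≡.cong (suc p ℕ.+_) (≡.sym (ℕₚ.*-suc p p)) ⟩
  suc p * suc p               ≡⟨ ≡.sym (≡.cong₂ _*_ qˢ≡1+p qˢ≡1+p) ⟩
  q ^ s * q ^ s               ≡⟨ ≡.sym (^-distribˡ-+-* q s s) ⟩
  q ^ (s ℕ.+ s)               ≤⟨ ^-monoʳ-≤ q s+s≤n ⟩
  q ^ n                       ∎
  where
  open ≤-Reasoning
  instance
    q≢0 : NonZero q
    q≢0 = >-nonZero (≤-trans (s≤s z≤n) 1<q)
  q≤1+p : q ≤ suc p
  q≤1+p = begin
    q       ≡⟨ ≡.sym (^-identityʳ q) ⟩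
    q ^ 1   ≤⟨ ^-monoʳ-≤ q {1} {s} (s≤s z≤n) ⟩
    q ^ s   ≡⟨ qˢ≡1+p ⟩
    suc p   ∎
  s+s≤n : s ℕ.+ s ≤ n
  s+s≤n = ≤-trans (≤-reflexive (≡.cong (s ℕ.+_) (≡.sym (ℕₚ.+-identityʳ s)))) 2s≤n
  0<p : 0 < p
  0<p with ≤-trans 1<q q≤1+p
  ... | s≤s (s≤s _) = s≤s z≤n

^-cancelʳ-≤ : ∀ {b} m d → 1 < b → b ^ m ≤ b ^ d → m ≤ d
^-cancelʳ-≤ {b} m d 1<b bᵐ≤bᵈ = ≮⇒≥ (λ d<m → <⇒≱ (^-monoʳ-< b 1<b d<m) bᵐ≤bᵈ)

distinct⇒1< : ∀ {m} (i j : Fin m) → i ≢ j → 1 < m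
distinct⇒1< {suc zero}    zero zero i≢j = contradiction ≡.refl i≢j
distinct⇒1< {suc (suc _)} _    _    _   = s≤s (s≤s z≤n)

<⇒∃-∉-image : ∀ {m n} → m < n → (f : Fin m → Fin n) → ∃ λ k → ∀ i → f i ≢ k
<⇒∃-∉-image {m} m<n f with any? (λ k → all? (λ i → ¬? (f i ≟ k)))
... | yes k∉ = k∉
... | no ¬∃k∉ = contradiction (injective⇒≤ preimage-injective) (<⇒≱ m<n)
  where
  preimage : ∀ k → ∃ λ i → f i ≡ k
  preimage k with i , ¬fi≢k ← ¬∀⟶∃¬ m _ (λ i → ¬? (f i ≟ k)) (λ k∉ → ¬∃k∉ (k , k∉))
    = i , decidable-stable (f i ≟ k) ¬fi≢k
  preimage-injective : Injective _≡_ _≡_ (proj₁ ∘ preimage)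
  preimage-injective {k} {k′} eq = ≡.trans (≡.sym (proj₂ (preimage k))) (≡.trans (≡.cong f eq) (proj₂ (preimage k′)))

funToFin-cong : ∀ {m n} {f g : Fin m → Fin n} → f ≗ g → funToFin f ≡ funToFin g
funToFin-cong {zero}  _   = ≡.refl
funToFin-cong {suc _} f≗g = ≡.cong₂ combine (f≗g zero) (funToFin-cong (f≗g ∘ suc))

finToFun-injective : ∀ {m n} {k k′ : Fin (n ^ m)} → finToFun k ≗ finToFun k′ → k ≡ k′
finToFun-injective {m} {n} {k} {k′} eq =
  ≡.trans (≡.sym (funToFin-finToFin {m} {n} k)) (≡.trans (funToFin-cong {m} {n} eq) (funToFin-finToFin {m} {n} k′))

module LinearCombination {c ℓ : Level} (R : CommutativeRing c ℓ) (K : CommutativeRing.Carrier R → Set ℓ) where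
  open CommutativeRing R renaming (_*_ to _·_) hiding (zero)
  open LinAlg _≈_ 0# K Carrier _≈_ _+_ 0# _·_ using (lc; KCoeffs; IsSubspace)
  open import Algebra.Properties.CommutativeSemigroup +-commutativeSemigroup using (interchange)
  open import Algebra.Properties.CommutativeSemigroup *-commutativeSemigroup using (x∙yz≈y∙xz)
  open import Algebra.Properties.Ring ring using (-1*x≈-x)

  lc-cong : ∀ {d} {cs ds bs bs′ : Fin d → Carrier} →
            (∀ i → cs i ≈ ds i) → (∀ i → bs i ≈ bs′ i) → lc cs bs ≈ lc ds bs′
  lc-cong {zero}  _    _     = refl
  lc-cong {suc _} cs≈ds bs≈bs′ = +-cong (*-cong (cs≈ds zero) (bs≈bs′ zero)) (lc-cong (cs≈ds ∘ suc) (bs≈bs′ ∘ suc))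

  lc-+ : ∀ {d} (cs ds bs : Fin d → Carrier) → lc cs bs + lc ds bs ≈ lc (λ i → cs i + ds i) bs
  lc-+ {zero}  _  _  _  = +-identityˡ 0#
  lc-+ {suc _} cs ds bs = trans (interchange _ _ _ _)
    (+-cong (sym (distribʳ (bs zero) (cs zero) (ds zero))) (lc-+ (cs ∘ suc) (ds ∘ suc) (bs ∘ suc)))

  ·-lc-coeffs : ∀ {d} a (cs bs : Fin d → Carrier) → a · lc cs bs ≈ lc (λ i → a · cs i) bs
  ·-lc-coeffs {zero}  a _  _  = zeroʳ a
  ·-lc-coeffs {suc _} a cs bs = trans (distribˡ a _ _)
    (+-cong (sym (*-assoc a (cs zero) (bs zero))) (·-lc-coeffs a (cs ∘ suc) (bs ∘ suc)))

  ·-lc-vectors : ∀ {d} a (cs bs : Fin d → Carrier) → a · lc cs bs ≈ lc cs (λ i → a · bs i)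
  ·-lc-vectors {zero}  a _  _  = zeroʳ a
  ·-lc-vectors {suc _} a cs bs = trans (distribˡ a _ _)
    (+-cong (x∙yz≈y∙xz a (cs zero) (bs zero)) (·-lc-vectors a (cs ∘ suc) (bs ∘ suc)))

  lc-0-coeffs : ∀ {d} (bs : Fin d → Carrier) → lc (λ _ → 0#) bs ≈ 0#
  lc-0-coeffs {zero}  _  = refl
  lc-0-coeffs {suc _} bs = trans (+-cong (zeroˡ (bs zero)) (lc-0-coeffs (bs ∘ suc))) (+-identityˡ 0#)

  -‿lc : ∀ {d} (cs bs : Fin d → Carrier) → - lc cs bs ≈ lc (λ i → - cs i) bs
  -‿lc cs bs = trans (sym (-1*x≈-x _)) (trans (·-lc-coeffs (- 1#) cs bs) (lc-cong (-1*x≈-x ∘ cs) (λ _ → refl)))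

  lc-closed : ∀ {p d} {P : Carrier → Set p} {cs bs : Fin d → Carrier} →
              IsSubspace P → KCoeffs cs → (∀ i → P (bs i)) → P (lc cs bs)
  lc-closed {d = zero}  P-sub _  _   = IsSubspace.has-0 P-sub
  lc-closed {d = suc _} P-sub kc bs∈ = IsSubspace.+-closed P-sub (IsSubspace.·-closed P-sub (kc zero) (bs∈ zero))
                                                                 (lc-closed P-sub (kc ∘ suc) (bs∈ ∘ suc))

module FiniteExtension {c ℓ : Level} {q n : ℕ} (F : FieldExt c ℓ q n) where
  open Proj F renaming (_*_ to _·_) hiding (zero)
  open LE using (lc; KCoeffs; LinIndep; IsSubspace; HasDim)
  open LinearCombination E K
  open import Relation.Binary.Reasoning.Setoid setoid
  open import Algebra.Properties.CommutativeSemigroup *-commutativeSemigroup using (interchange)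
  open import Algebra.Properties.Group +-group using (x∙y⁻¹≈ε⇒x≈y; inverseˡ-unique)

  inverse : ∀ {x} → ¬ x ≈ 0# → Carrier
  inverse {x} x≉0 = proj₁ (inv x x≉0)

  ·-inverseʳ : ∀ {x} (x≉0 : ¬ x ≈ 0#) → x · inverse x≉0 ≈ 1#
  ·-inverseʳ {x} x≉0 = proj₂ (inv x x≉0)

  cx≈b⇒x≈b/c : ∀ {b c x} (c≉0 : ¬ c ≈ 0#) → c · x ≈ b → x ≈ b · inverse c≉0
  cx≈b⇒x≈b/c {b} {c} {x} c≉0 cx≈b = begin
    x                         ≈⟨ sym (*-identityʳ x) ⟩
    x · 1#                    ≈⟨ *-congˡ (sym (·-inverseʳ c≉0)) ⟩
    x · (c · inverse c≉0)     ≈⟨ sym (*-assoc x c _) ⟩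
    (x · c) · inverse c≉0     ≈⟨ *-congʳ (trans (*-comm x c) cx≈b) ⟩
    b · inverse c≉0           ∎

  x/c·c≈x : ∀ {c} (c≉0 : ¬ c ≈ 0#) x → (x · inverse c≉0) · c ≈ x
  x/c·c≈x {c} c≉0 x = begin
    (x · inverse c≉0) · c     ≈⟨ *-assoc x _ c ⟩
    x · (inverse c≉0 · c)     ≈⟨ *-congˡ (trans (*-comm _ c) (·-inverseʳ c≉0)) ⟩
    x · 1#                    ≈⟨ *-identityʳ x ⟩
    x                         ∎

  ·-≉0 : ∀ {a x} → ¬ a ≈ 0# → ¬ x ≈ 0# → ¬ a · x ≈ 0#
  ·-≉0 {a} a≉0 x≉0 ax≈0 = x≉0 (trans (cx≈b⇒x≈b/c a≉0 ax≈0) (zeroˡ _))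

  inverse-≉0 : ∀ {x} (x≉0 : ¬ x ≈ 0#) → ¬ inverse x≉0 ≈ 0#
  inverse-≉0 {x} x≉0 x⁻¹≈0 = 1≉0 (trans (sym (·-inverseʳ x≉0)) (trans (*-congˡ x⁻¹≈0) (zeroʳ x)))

  -- Coefficients are indices into the enumeration Kelem of K, which keeps Span bs in Set ℓ.
  Span : ∀ {d} → (Fin d → Carrier) → Carrier → Set ℓ
  Span {d} bs z = Σ (Fin d → Fin q) λ is → z ≈ lc (Kelem ∘ is) bs

  combination⇒Span : ∀ {d} {cs bs : Fin d → Carrier} {z} → KCoeffs cs → z ≈ lc cs bs → Span bs z
  combination⇒Span {cs = cs} kc z≈ =
    (λ i → proj₁ (Kelem-sur (cs i) (kc i))) , trans z≈ (lc-cong (λ i → proj₂ (Kelem-sur (cs i) (kc i))) (λ _ → refl))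

  Spans⇒⊆Span : ∀ {p d} {P : Carrier → Set p} {bs : Fin d → Carrier} → LE.Spans P bs → ∀ {z} → P z → Span bs z
  Spans⇒⊆Span spans {z} z∈P with cs , kc , z≈ ← spans z z∈P = combination⇒Span kc z≈

  Span-spans : ∀ {d} (bs : Fin d → Carrier) → LE.Spans (Span bs) bs
  Span-spans bs z (is , z≈) = Kelem ∘ is , Kelem-K ∘ is , z≈

  Span-isSubspace : ∀ {d} {bs : Fin d → Carrier} → IsSubspace (Span bs)
  Span-isSubspace {bs = bs} = record
    { resp     = λ { x≈y (is , x≈) → is , trans (sym x≈y) x≈ }
    ; has-0    = combination⇒Span (λ _ → K-0) (sym (lc-0-coeffs bs))
    ; +-closed = λ { (is , x≈) (js , y≈) → combination⇒Span (λ i → K-+ (Kelem-K (is i)) (Kelem-K (js i)))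
                                                             (trans (+-cong x≈ y≈) (lc-+ _ _ bs)) }
    ; ·-closed = λ { {a} a∈K (is , x≈) → combination⇒Span (λ i → K-* a∈K (Kelem-K (is i)))
                                                           (trans (*-congˡ x≈) (·-lc-coeffs a _ bs)) }
    }

  Span-suc : ∀ {d} {bs : Fin (suc d) → Carrier} {z} → Span (bs ∘ suc) z → Span bs z
  Span-suc {bs = bs} (is , z≈) =
    combination⇒Span {cs = 0# ∷ Kelem ∘ is} {bs} (λ { zero → K-0 ; (suc i) → Kelem-K (is i) })
    (trans z≈ (sym (trans (+-congʳ (zeroˡ (bs zero))) (+-identityˡ _))))

  Span-∋ : ∀ {d} (bs : Fin d → Carrier) i → Span bs (bs i)
  Span-∋ bs zero    = combination⇒Span {cs = 1# ∷ λ _ → 0#} {bs} (λ { zero → K-1 ; (suc _) → K-0 })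
    (sym (trans (+-congˡ (lc-0-coeffs (bs ∘ suc))) (trans (+-identityʳ _) (*-identityˡ _))))
  Span-∋ bs (suc i) = Span-suc {bs = bs} (Span-∋ (bs ∘ suc) i)

  Span-dim : ∀ {d} {bs : Fin d → Carrier} → LinIndep bs → HasDim (Span bs) d
  Span-dim {bs = bs} bs-indep = bs , Span-∋ bs , bs-indep , Span-spans bs

  enum : ∀ {d} → (Fin d → Carrier) → Fin (q ^ d) → Carrier
  enum bs k = lc (Kelem ∘ finToFun k) bs

  Span⇒enum : ∀ {d} {bs : Fin d → Carrier} {z} → Span bs z → ∃ λ k → z ≈ enum bs k
  Span⇒enum (is , z≈) =
    funToFin is , trans z≈ (lc-cong (λ i → reflexive (≡.cong Kelem (≡.sym (finToFun-funToFin is i)))) (λ _ → refl))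

  lc-injective : ∀ {d} {cs ds bs : Fin d → Carrier} → LinIndep bs → KCoeffs cs → KCoeffs ds →
                 lc cs bs ≈ lc ds bs → ∀ i → cs i ≈ ds i
  lc-injective {cs = cs} {ds} {bs} bs-indep kc kd lc≈lc i =
    x∙y⁻¹≈ε⇒x≈y _ _ (bs-indep (λ i → cs i - ds i) (λ i → K-+ (kc i) (K-neg (kd i))) lc-difference≈0 i)
    where
    lc-difference≈0 : lc (λ i → cs i - ds i) bs ≈ 0#
    lc-difference≈0 = begin
      lc (λ i → cs i - ds i) bs          ≈⟨ sym (lc-+ cs _ bs) ⟩
      lc cs bs + lc (λ i → - ds i) bs    ≈⟨ +-congˡ (sym (-‿lc ds bs)) ⟩
      lc cs bs - lc ds bs                ≈⟨ +-congʳ lc≈lc ⟩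
      lc ds bs - lc ds bs                ≈⟨ -‿inverseʳ _ ⟩
      0#                                 ∎

  enum-injective : ∀ {d} {bs : Fin d → Carrier} → LinIndep bs → ∀ {k k′} → enum bs k ≈ enum bs k′ → k ≡ k′
  enum-injective bs-indep eq =
    finToFun-injective (λ i → Kelem-inj _ _ (lc-injective bs-indep (Kelem-K ∘ _) (Kelem-K ∘ _) eq i))

  1<q : 1 < q
  1<q = distinct⇒1< (proj₁ 0∈K) (proj₁ 1∈K)
          (λ i₀≡i₁ → 1≉0 (trans (proj₂ 1∈K) (trans (reflexive (≡.cong Kelem (≡.sym i₀≡i₁))) (sym (proj₂ 0∈K)))))
    where
    0∈K : Σ (Fin q) λ i → 0# ≈ Kelem i
    0∈K = Kelem-sur 0# K-0
    1∈K : Σ (Fin q) λ i → 1# ≈ Kelem i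
    1∈K = Kelem-sur 1# K-1

  -- Counting: the q ^ m combinations of cs are distinct elements of Span bs, which has at most q ^ d.
  indep-in-Span⇒≤ : ∀ {m d} {cs : Fin m → Carrier} (bs : Fin d → Carrier) →
                    LinIndep cs → (∀ i → Span bs (cs i)) → m ≤ d
  indep-in-Span⇒≤ {m} {d} {cs} bs cs-indep cs⊆ = ^-cancelʳ-≤ m d 1<q (injective⇒≤ reindex-injective)
    where
    reindex : ∀ k → ∃ λ k′ → enum cs k ≈ enum bs k′
    reindex k = Span⇒enum (lc-closed Span-isSubspace (Kelem-K ∘ finToFun k) cs⊆)
    reindex-injective : Injective _≡_ _≡_ (proj₁ ∘ reindex)
    reindex-injective {k} {k′} eq = enum-injective cs-indep
      (trans (proj₂ (reindex k)) (trans (reflexive (≡.cong (enum bs) eq)) (sym (proj₂ (reindex k′)))))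

  private
    basis : Fin n → Carrier
    basis = proj₁ degree

    basis-indep : LinIndep basis
    basis-indep = proj₁ (proj₂ (proj₂ degree))

    code : Carrier → Fin (q ^ n)
    code x = proj₁ (Span⇒enum (Spans⇒⊆Span (proj₂ (proj₂ (proj₂ degree))) {x} tt))

    code-spec : ∀ x → x ≈ enum basis (code x)
    code-spec x = proj₂ (Span⇒enum (Spans⇒⊆Span (proj₂ (proj₂ (proj₂ degree))) {x} tt))

    code-cong : ∀ {x y} → x ≈ y → code x ≡ code y
    code-cong {x} {y} x≈y = enum-injective basis-indep (trans (sym (code-spec x)) (trans x≈y (code-spec y)))

    code-enum : ∀ k → code (enum basis k) ≡ k
    code-enum k = enum-injective basis-indep (sym (code-spec (enum basis k)))

  _≈?_ : ∀ x y → Dec (x ≈ y)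
  x ≈? y = map′ (λ eq → trans (code-spec x) (trans (reflexive (≡.cong (enum basis) eq)) (sym (code-spec y))))
                code-cong (code x ≟ code y)

  ∃-outside : ∀ {m} (f : Fin m → Carrier) → m < q ^ n → ∃ λ x → ∀ j → ¬ x ≈ f j
  ∃-outside f m<qⁿ with k , k∉ ← <⇒∃-∉-image m<qⁿ (code ∘ f) =
    enum basis k , λ j x≈fj → k∉ j (≡.trans (≡.sym (code-cong x≈fj)) (code-enum k))

  Span? : ∀ {d} (bs : Fin d → Carrier) y → Dec (Span bs y)
  Span? bs y = map′ (Σ-map finToFun id) Span⇒enum (any? (λ k → y ≈? enum bs k))

  indep-∷ : ∀ {d} {bs : Fin d → Carrier} {y} → LinIndep bs → ¬ Span bs y → LinIndep (y ∷ bs)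
  indep-∷ {bs = bs} {y} bs-indep y∉ cs kc lc≈0 with cs zero ≈? 0#
  ... | yes c₀≈0 = λ { zero → c₀≈0 ; (suc i) → bs-indep (cs ∘ suc) (kc ∘ suc) tail≈0 i }
    where
    tail≈0 : lc (cs ∘ suc) bs ≈ 0#
    tail≈0 = trans (sym (+-identityˡ _)) (trans (+-congʳ (sym (trans (*-congʳ c₀≈0) (zeroˡ y)))) lc≈0)
  ... | no c₀≉0 = contradiction (combination⇒Span coeffs∈K y≈) y∉
    where
    c₀⁻¹ : Carrier
    c₀⁻¹ = inverse c₀≉0
    coeffs∈K : KCoeffs (λ i → c₀⁻¹ · - cs (suc i))
    coeffs∈K i = K-* (K-inv (kc zero) (·-inverseʳ c₀≉0)) (K-neg (kc (suc i)))
    y≈ : y ≈ lc (λ i → c₀⁻¹ · - cs (suc i)) bs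
    y≈ = begin
      y                                   ≈⟨ cx≈b⇒x≈b/c c₀≉0 (inverseˡ-unique _ _ lc≈0) ⟩
      - lc (cs ∘ suc) bs · c₀⁻¹           ≈⟨ *-comm _ c₀⁻¹ ⟩
      c₀⁻¹ · - lc (cs ∘ suc) bs           ≈⟨ *-congˡ (-‿lc (cs ∘ suc) bs) ⟩
      c₀⁻¹ · lc (λ i → - cs (suc i)) bs   ≈⟨ ·-lc-coeffs c₀⁻¹ _ bs ⟩
      lc (λ i → c₀⁻¹ · - cs (suc i)) bs   ∎

  indep-in-Span⇒spans : ∀ {m} {cs bs : Fin m → Carrier} → LinIndep cs → (∀ i → Span bs (cs i)) →
                        ∀ {y} → Span bs y → Span cs y
  indep-in-Span⇒spans {m} {cs} {bs} cs-indep cs⊆ {y} y∈ with Span? cs y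
  ... | yes y∈cs = y∈cs
  ... | no y∉cs = contradiction (indep-in-Span⇒≤ {cs = y ∷ cs} bs (indep-∷ cs-indep y∉cs) y∷cs⊆) (n≮n m)
    where
    y∷cs⊆ : ∀ i → Span bs ((y ∷ cs) i)
    y∷cs⊆ zero    = y∈
    y∷cs⊆ (suc i) = cs⊆ i

  extend-indep : ∀ {m m′} {bs : Fin m → Carrier} → LinIndep bs → m ≤′ m′ → m′ ≤ n →
                 Σ (Fin m′ → Carrier) λ bs′ → LinIndep bs′ × (∀ {z} → Span bs z → Span bs′ z)
  extend-indep bs-indep ≤′-refl _ = _ , bs-indep , id
  extend-indep bs-indep (≤′-step m≤′m′) m′<n
    with bs′ , bs′-indep , ⊆bs′ ← extend-indep bs-indep m≤′m′ (<⇒≤ m′<n)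
    with y , y∉ ← ∃-outside (enum bs′) (^-monoʳ-< q 1<q m′<n)
    = y ∷ bs′ , indep-∷ bs′-indep (λ y∈ → uncurry y∉ (Span⇒enum y∈)) , λ z∈ → Span-suc {bs = y ∷ bs′} (⊆bs′ z∈)

  indep-x∷1∷[] : ∀ {x} → ¬ K x → LinIndep (x ∷ 1# ∷ [])
  indep-x∷1∷[] {x} x∉K = indep-∷ {bs = 1# ∷ []} (indep-∷ {bs = []} (λ _ _ _ ()) λ { (_ , 1≈0) → 1≉0 1≈0 })
    λ { (is , x≈) → x∉K (K-resp (sym (trans x≈ (trans (+-identityʳ _) (*-identityʳ _)))) (Kelem-K (is zero))) }

  ∃-indep-Span∋1,x : ∀ {r x} → ¬ K x → 2 ≤ r → r ≤ n →
                     Σ (Fin r → Carrier) λ bs → LinIndep bs × Span bs 1# × Span bs x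
  ∃-indep-Span∋1,x {x = x} x∉K 2≤r r≤n
    with bs , bs-indep , ⊆bs ← extend-indep {bs = x ∷ 1# ∷ []} (indep-x∷1∷[] x∉K) (≤⇒≤′ 2≤r) r≤n
    = bs , bs-indep , ⊆bs (Span-∋ (x ∷ 1# ∷ []) (suc zero)) , ⊆bs (Span-∋ (x ∷ 1# ∷ []) zero)

  punctured-enumeration : ∀ {N} (e : Fin N → Carrier) → (∀ {k k′} → e k ≈ e k′ → k ≡ k′) → ∀ k₀ → e k₀ ≈ 0# →
    Σ ℕ λ p → N ≡ suc p × Σ (Fin p → Carrier) λ e′ →
      (∀ j → ¬ e′ j ≈ 0#) × (∀ k → ¬ e k ≈ 0# → ∃ λ j → e k ≈ e′ j)
  punctured-enumeration {suc p} e e-injective k₀ eₖ₀≈0 = p , ≡.refl , e ∘ punchIn k₀ , punchIn≉0 , ≉0⇒punchIn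
    where
    punchIn≉0 : ∀ j → ¬ e (punchIn k₀ j) ≈ 0#
    punchIn≉0 j e≈0 = punchInᵢ≢i k₀ j (e-injective (trans e≈0 (sym eₖ₀≈0)))
    ≉0⇒punchIn : ∀ k → ¬ e k ≈ 0# → ∃ λ j → e k ≈ e (punchIn k₀ j)
    ≉0⇒punchIn k eₖ≉0 = punchOut k₀≢k , reflexive (≡.cong e (≡.sym (punchIn-punchOut k₀≢k)))
      where
      k₀≢k : k₀ ≢ k
      k₀≢k k₀≡k = eₖ≉0 (trans (reflexive (≡.cong e (≡.sym k₀≡k))) eₖ₀≈0)

  nonzero-enumeration : ∀ {d} {bs : Fin d → Carrier} → LinIndep bs →
    Σ ℕ λ p → q ^ d ≡ suc p × Σ (Fin p → Carrier) λ nz →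
      (∀ j → ¬ nz j ≈ 0#) × (∀ {z} → Span bs z → ¬ z ≈ 0# → ∃ λ j → z ≈ nz j)
  nonzero-enumeration {bs = bs} bs-indep
    with k₀ , 0≈eₖ₀ ← Span⇒enum (IsSubspace.has-0 (Span-isSubspace {bs = bs}))
    with p , qᵈ≡1+p , nz , nz≉0 , nz-covers ← punctured-enumeration (enum bs) (enum-injective bs-indep) k₀ (sym 0≈eₖ₀)
    = p , qᵈ≡1+p , nz , nz≉0 , covers
    where
    covers : ∀ {z} → Span bs z → ¬ z ≈ 0# → ∃ λ j → z ≈ nz j
    covers z∈ z≉0 with k , z≈eₖ ← Span⇒enum z∈ with j , eₖ≈ ← nz-covers k (λ eₖ≈0 → z≉0 (trans z≈eₖ eₖ≈0)) =
      j , trans z≈eₖ eₖ≈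

  ratio : ∀ {p} {nz : Fin p → Carrier} → (∀ j → ¬ nz j ≈ 0#) → Fin p → Fin p → Carrier
  ratio {nz = nz} nz≉0 j₁ j₂ = nz j₂ · inverse (nz≉0 j₁)

  NotRatioOf : (Carrier → Set ℓ) → Carrier → Set (c ⊔ ℓ)
  NotRatioOf S x = ∀ a → ¬ a ≈ 0# → S a → ¬ S (a · x)

  ∃-non-ratio : ∀ {s} {S : Carrier → Set ℓ} → HasDim S s → 2 * s ≤ n → 2 ≤ n →
                Σ Carrier λ x → ¬ K x × NotRatioOf S x
  ∃-non-ratio {s} {S} (sb , _ , sb-indep , sb-spans) 2s≤n 2≤n
    with p , qˢ≡1+p , nz , nz≉0 , nz-covers ← nonzero-enumeration sb-indep
    with x , x∉ ← ∃-outside (Kelem ++ uncurry (ratio nz≉0) ∘ remQuot {p} p) (q+p*p<q^n {s = s} 1<q qˢ≡1+p 2s≤n 2≤n)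
    = x , x∉K , x-not-ratio
    where
    x∉K : ¬ K x
    x∉K x∈K with i , x≈ ← Kelem-sur x x∈K = x∉ (i ↑ˡ p * p) (trans x≈ (reflexive (≡.sym (lookup-++ˡ Kelem _ i))))
    x-not-ratio : NotRatioOf S x
    x-not-ratio a a≉0 a∈S ax∈S
      with j₁ , a≈ ← nz-covers (Spans⇒⊆Span sb-spans a∈S) a≉0
      with j₂ , ax≈ ← nz-covers (Spans⇒⊆Span sb-spans ax∈S) (·-≉0 a≉0 (λ x≈0 → x∉K (K-resp (sym x≈0) K-0)))
      = x∉ (q ↑ʳ combine j₁ j₂) (trans (cx≈b⇒x≈b/c (nz≉0 j₁) (trans (*-congʳ (sym a≈)) ax≈)) (reflexive (≡.sym lookup)))
      where
      lookup : (Kelem ++ uncurry (ratio nz≉0) ∘ remQuot {p} p) (q ↑ʳ combine j₁ j₂) ≡ ratio nz≉0 j₁ j₂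
      lookup = ≡.trans (lookup-++ʳ Kelem _ (combine j₁ j₂)) (≡.cong (uncurry (ratio nz≉0)) (remQuot-combine j₁ j₂))

  proj₁-lc : ∀ {d} (cs : Fin d → Carrier) (w : Fin d → E²) → proj₁ (L2.lc cs w) ≈ lc cs (proj₁ ∘ w)
  proj₁-lc {zero}  _  _ = refl
  proj₁-lc {suc _} cs w = +-congˡ (proj₁-lc (cs ∘ suc) (w ∘ suc))

  proj₂-lc : ∀ {d} (cs : Fin d → Carrier) (w : Fin d → E²) → proj₂ (L2.lc cs w) ≈ lc cs (proj₂ ∘ w)
  proj₂-lc {zero}  _  _ = refl
  proj₂-lc {suc _} cs w = +-congˡ (proj₂-lc (cs ∘ suc) (w ∘ suc))

  indep-proj₁ : ∀ {d} {w : Fin d → E²} {a} → L2.LinIndep w → (∀ i → proj₂ (w i) ≈ a · proj₁ (w i)) →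
                LinIndep (proj₁ ∘ w)
  indep-proj₁ {w = w} {a} w-indep w₂≈aw₁ cs kc lc≈0 = w-indep cs kc (trans (proj₁-lc cs w) lc≈0 , lc₂≈0)
    where
    lc₂≈0 : proj₂ (L2.lc cs w) ≈ 0#
    lc₂≈0 = begin
      proj₂ (L2.lc cs w)               ≈⟨ proj₂-lc cs w ⟩
      lc cs (proj₂ ∘ w)                ≈⟨ lc-cong (λ _ → refl) w₂≈aw₁ ⟩
      lc cs (λ i → a · proj₁ (w i))    ≈⟨ sym (·-lc-vectors a cs _) ⟩
      a · lc cs (proj₁ ∘ w)            ≈⟨ *-congˡ lc≈0 ⟩
      a · 0#                           ≈⟨ zeroʳ a ⟩
      0#                               ∎

  indep-proj₂ : ∀ {d} {w : Fin d → E²} {a} → L2.LinIndep w → (∀ i → proj₁ (w i) ≈ a · proj₂ (w i)) →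
                LinIndep (proj₂ ∘ w)
  indep-proj₂ {w = w} {a} w-indep w₁≈aw₂ cs kc lc≈0 = w-indep cs kc (lc₁≈0 , trans (proj₂-lc cs w) lc≈0)
    where
    lc₁≈0 : proj₁ (L2.lc cs w) ≈ 0#
    lc₁≈0 = begin
      proj₁ (L2.lc cs w)               ≈⟨ proj₁-lc cs w ⟩
      lc cs (proj₁ ∘ w)                ≈⟨ lc-cong (λ _ → refl) w₁≈aw₂ ⟩
      lc cs (λ i → a · proj₂ (w i))    ≈⟨ sym (·-lc-vectors a cs _) ⟩
      a · lc cs (proj₂ ∘ w)            ≈⟨ *-congˡ lc≈0 ⟩
      a · 0#                           ≈⟨ zeroʳ a ⟩
      0#                               ∎

  ∈⟨⟩⇒proj₁≈ : ∀ {s₀ t₀ w} (t₀≉0 : ¬ t₀ ≈ 0#) → ⟨ s₀ , t₀ ⟩ w → proj₁ w ≈ (s₀ · inverse t₀≉0) · proj₂ w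
  ∈⟨⟩⇒proj₁≈ {s₀} {t₀} {w} t₀≉0 (a , w₁≈as₀ , w₂≈at₀) = begin
    proj₁ w                          ≈⟨ w₁≈as₀ ⟩
    a · s₀                           ≈⟨ sym (*-identityʳ _) ⟩
    (a · s₀) · 1#                    ≈⟨ *-cong (*-comm a s₀) (sym (trans (*-comm _ t₀) (·-inverseʳ t₀≉0))) ⟩
    (s₀ · a) · (inverse t₀≉0 · t₀)   ≈⟨ interchange s₀ a _ t₀ ⟩
    (s₀ · inverse t₀≉0) · (a · t₀)   ≈⟨ *-congˡ (sym w₂≈at₀) ⟩
    (s₀ · inverse t₀≉0) · proj₂ w    ∎

  on-second-axis : ∀ {u} → proj₁ u ≈ 0# → SamePoint u (0# , 1#)
  on-second-axis {s₀ , t₀} s₀≈0 = t₀ , trans s₀≈0 (sym (zeroʳ t₀)) , sym (*-identityʳ t₀)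

  on-first-axis : ∀ {u} → proj₂ u ≈ 0# → SamePoint u (1# , 0#)
  on-first-axis {s₀ , t₀} t₀≈0 = s₀ , sym (*-identityʳ s₀) , trans t₀≈0 (sym (zeroʳ s₀))

  weight-on-first-axis : ∀ {s r} {S T : Carrier → Set ℓ} {u} → IsSubspace T → HasDim S s →
                         ¬ proj₁ u ≈ 0# → proj₂ u ≈ 0# → HasWeight (S ⊠ T) u r → s ≡ r
  weight-on-first-axis {u = s₀ , t₀} T-sub (sb , sb∈S , sb-indep , sb-spans) s₀≉0 t₀≈0 (w , w∈ , w-indep , w-spans) =
    ≤-antisym (indep-in-Span⇒≤ (proj₁ ∘ w) sb-indep sb⊆) (indep-in-Span⇒≤ sb (indep-proj₁ w-indep w₂≈0·w₁) ⊆sb)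
    where
    w₂≈0·w₁ : ∀ i → proj₂ (w i) ≈ 0# · proj₁ (w i)
    w₂≈0·w₁ i with a , _ , w₂≈at₀ ← proj₂ (w∈ i) =
      trans w₂≈at₀ (trans (*-congˡ t₀≈0) (trans (zeroʳ a) (sym (zeroˡ _))))
    ⊆sb : ∀ i → Span sb (proj₁ (w i))
    ⊆sb i = Spans⇒⊆Span sb-spans (proj₁ (proj₁ (w∈ i)))
    sb⊆ : ∀ j → Span (proj₁ ∘ w) (sb j)
    sb⊆ j with cs , kc , sbⱼ≈ , _ ← w-spans (sb j , 0#) ((sb∈S j , IsSubspace.has-0 T-sub) ,
                                         sb j · inverse s₀≉0 , sym (x/c·c≈x s₀≉0 (sb j)) ,
                                         sym (trans (*-congˡ t₀≈0) (zeroʳ _))) =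
      combination⇒Span kc (trans sbⱼ≈ (proj₁-lc cs w))

  no-weight-off-axes : ∀ {r x} {S : Carrier → Set ℓ} {bs : Fin r → Carrier} {u} → IsSubspace S →
                       Span bs 1# → Span bs x → NotRatioOf S x →
                       ¬ proj₁ u ≈ 0# → ¬ proj₂ u ≈ 0# → ¬ HasWeight (S ⊠ Span bs) u r
  no-weight-off-axes {r} {_} {S} {bs} {s₀ , t₀} S-sub 1∈ x∈ x-not-ratio s₀≉0 t₀≉0 (w , w∈ , w-indep , _) =
    x-not-ratio ρ (·-≉0 s₀≉0 (inverse-≉0 t₀≉0)) (IsSubspace.resp S-sub (*-identityʳ ρ) (ρ·∈S (⊆τ 1∈))) (ρ·∈S (⊆τ x∈))
    where
    ρ : Carrier
    ρ = s₀ · inverse t₀≉0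
    τ : Fin r → Carrier
    τ = proj₂ ∘ w
    w₁≈ρτ : ∀ i → proj₁ (w i) ≈ ρ · τ i
    w₁≈ρτ i = ∈⟨⟩⇒proj₁≈ t₀≉0 (proj₂ (w∈ i))
    ⊆τ : ∀ {z} → Span bs z → Span τ z
    ⊆τ = indep-in-Span⇒spans (indep-proj₂ w-indep w₁≈ρτ) (λ i → proj₂ (proj₁ (w∈ i)))
    ρ·∈S : ∀ {z} → Span τ z → S (ρ · z)
    ρ·∈S {z} (is , z≈) = IsSubspace.resp S-sub (sym ρz≈) (lc-closed S-sub (Kelem-K ∘ is) (λ i → proj₁ (proj₁ (w∈ i))))
      where
      ρz≈ : ρ · z ≈ lc (Kelem ∘ is) (proj₁ ∘ w)
      ρz≈ = begin
        ρ · z                           ≈⟨ *-congˡ z≈ ⟩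
        ρ · lc (Kelem ∘ is) τ           ≈⟨ ·-lc-vectors ρ _ τ ⟩
        lc (Kelem ∘ is) (λ i → ρ · τ i) ≈⟨ lc-cong (λ _ → refl) (λ i → sym (w₁≈ρτ i)) ⟩
        lc (Kelem ∘ is) (proj₁ ∘ w)     ∎

  weight-r-points : ∀ {s r x} {S : Carrier → Set ℓ} {bs : Fin r → Carrier} → IsSubspace S → HasDim S s →
                    Span bs 1# → Span bs x → NotRatioOf S x →
                    ∀ u → HasWeight (S ⊠ Span bs) u r → SamePoint u (0# , 1#) ⊎ ((s ≡ r) × SamePoint u (1# , 0#))
  weight-r-points S-sub S-dim 1∈ x∈ x-not-ratio u@(s₀ , t₀) weight-r with s₀ ≈? 0# | t₀ ≈? 0#
  ... | yes s₀≈0 | _        = inj₁ (on-second-axis {u} s₀≈0)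
  ... | no s₀≉0  | yes t₀≈0 = inj₂ (weight-on-first-axis {u = u} Span-isSubspace S-dim s₀≉0 t₀≈0 weight-r ,
                                    on-first-axis {u} t₀≈0)
  ... | no s₀≉0  | no t₀≉0  = ⊥-elim (no-weight-off-axes {u = u} S-sub 1∈ x∈ x-not-ratio s₀≉0 t₀≉0 weight-r)

proposition2p2 : {c ℓ : Level} (q n k r : ℕ) → IsPrimePower q
    → 1 ≤ n → 1 ≤ k → 2 ≤ r → r ≤ k → k ≤ n → 2 * (k ∸ r) ≤ n
    → (F : FieldExt c ℓ q n)
    → let open Proj F in
      (S : Carrier → Set ℓ) → LE.IsSubspace S → LE.HasDim S (k ∸ r)
    → Σ (Carrier → Set ℓ) λ T → LE.IsSubspace T × LE.HasDim T r
        × (∀ u → (S ⊠ T) u → ¬ (u ≈² 0²) → HasWeight (S ⊠ T) u r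
             → SamePoint u (0# , 1#) ⊎ ((k ∸ r ≡ r) × SamePoint u (1# , 0#)))
proposition2p2 q n k r _ _ _ 2≤r r≤k k≤n 2s≤n F S S-sub S-dim =
  let open FiniteExtension F
      r≤n : r ≤ n
      r≤n = ≤-trans r≤k k≤n
      x , x∉K , x-not-ratio = ∃-non-ratio S-dim 2s≤n (≤-trans 2≤r r≤n)
      bs , bs-indep , 1∈T , x∈T = ∃-indep-Span∋1,x x∉K 2≤r r≤n
  in Span bs , Span-isSubspace , Span-dim bs-indep , λ u _ _ → weight-r-points S-sub S-dim 1∈T x∈T x-not-ratio u
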